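{- Let $n\ge 2$, $i\ge 0$ and $1\le k\le n$, and suppose $\mathcal{L}_i\cap\mathcal{B}_k\neq\emptyset$. Then $\mathcal{L}_i\cap\mathcal{B}_k$ contains at most one element of the form $x_1^t\partial_k$ ($t\ge 0$); if it contains such an element, it is the unique element of minimum weight-degree in $\mathcal{L}_i\cap\mathcal{B}_k$, and its exponent is $t=i-h_i(n-k)+1$.
   Context: Let $n\ge 2$ be an integer. A partition is a sequence $\Lambda=(\lambda_s)_{s\ge 1}$ of non-negative integers with finite support; $\mathrm{wt}(\Lambda)=\sum_s s\lambda_s$; $x^\Lambda=\prod_s x_s^{\lambda_s}$ (monomial in commuting indeterminates), $\deg(x^\Lambda)=\sum_s\lambda_s$. $\mathrm{Part}(j)$ is the set of partitions with $\lambda_s=0$ for $s>j$; $\partial_k$ is the partial derivative with respect to $x_k$. Let $\mathcal{B}=\{x^\Lambda\partial_k:1\le k\le n,\ \Lambda\in\mathrm{Part}(k-1)\}$ and $\mathcal{B}_u=\{x^\Lambda\partial_k\in\mathcal{B}:k=u\}$. For an integer $i\ge -1$ let $r_i\in\{1,\dots,n-1\}$ with $i\equiv r_i\pmod{n-1}$ and $h_i=\lfloor (i-1)/(n-1)\rfloor+1$. For $x^\Lambda\partial_k\in\mathcal{B}$ define the weight-degree $\mathrm{WD}(x^\Lambda\partial_k)=\mathrm{wt}(\Lambda)-\deg(x^\Lambda)+n-k$ and $\mathrm{lev}_i(x^\Lambda\partial_k)=h_i\,\mathrm{WD}(x^\Lambda\partial_k)+\deg(x^\Lambda)-1$. For $i\ge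 -1$ let $\mathcal{N}_i=\{b\in\mathcal{B}: \mathrm{lev}_j(b)\le j \text{ for some integer } j \text{ with } -1\le j\le i\}$, and for $i\ge 0$ let $\mathcal{L}_i=\mathcal{N}_i\setminus\mathcal{N}_{i-1}$. -}

module Defs where

open import Data.Nat as ℕ using (ℕ; zero; suc)
open import Data.Integer as ℤ using (ℤ; +_; _/ℕ_)
open import Data.Vec using (Vec; []; _∷_)
open import Data.Product using (Σ; _×_)
open import Relation.Nullary using (¬_)
open import Relation.Binary.PropositionalEquality using (_≡_)

-- A partition Λ ∈ Part(j) is represented by the vector (λ₁, …, λⱼ) : Vec ℕ j
-- (all λ_s with s > j are 0).  An element x^Λ ∂_k of 𝓑_k (1 ≤ k ≤ n) is
-- represented by its partition Λ : Vec ℕ (k ∸ 1), i.e. Λ ∈ Part(k-1).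

Part : ℕ → Set
Part j = Vec ℕ j

-- λ_s for s ≥ 1 (0 outside the support of the vector); λ at index 0 is set to 0
lam : ∀ {j} → Part j → ℕ → ℕ
lam []       _             = 0
lam (x ∷ xs) zero          = 0
lam (x ∷ xs) (suc zero)    = x
lam (x ∷ xs) (suc (suc s)) = lam xs (suc s)

x1exp : ℕ → ℕ → ℕ
x1exp t (suc zero) = t
x1exp t _          = 0

IsX1Pow : ∀ {j} → ℕ → Part j → Set
IsX1Pow t Λ = ∀ s → lam Λ s ≡ x1exp t s

wtFrom : ∀ {j} → ℕ → Part j → ℕ
wtFrom s []       = 0
wtFrom s (x ∷ xs) = s ℕ.* x ℕ.+ wtFrom (suc s) xs

wt : ∀ {j} → Part j → ℕ
wt = wtFrom 1

deg : ∀ {j} → Part j → ℕ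
deg []       = 0
deg (x ∷ xs) = x ℕ.+ deg xs

-- h_i = ⌊(i-1)/(n-1)⌋ + 1 (floor division).  The divisor n-1 is written
-- suc (n ∸ 2), which equals n - 1 under the standing hypothesis n ≥ 2.
h : (n : ℕ) → ℤ → ℤ
h n i = ((i ℤ.- ℤ.1ℤ) /ℕ suc (n ℕ.∸ 2)) ℤ.+ ℤ.1ℤ

WD : (n k : ℕ) → Part (k ℕ.∸ 1) → ℤ
WD n k Λ = (+ wt Λ ℤ.- + deg Λ) ℤ.+ + n ℤ.- + k

lev : (n : ℕ) → ℤ → (k : ℕ) → Part (k ℕ.∸ 1) → ℤ
lev n i k Λ = (h n i ℤ.* WD n k Λ ℤ.+ + deg Λ) ℤ.- ℤ.1ℤ

InN : (n : ℕ) → ℤ → (k : ℕ) → Part (k ℕ.∸ 1) → Set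
InN n i k Λ = Σ ℤ (λ j → (ℤ.-1ℤ ℤ.≤ j) × (j ℤ.≤ i) × (lev n j k Λ ℤ.≤ j))

InL : (n i k : ℕ) → Part (k ℕ.∸ 1) → Set
InL n i k Λ = InN n (+ i) k Λ × ¬ InN n (+ i ℤ.- ℤ.1ℤ) k Λ

module Submission where

open import Defs
open import Data.Nat as ℕ using (ℕ; _≤_; zero; suc)
open import Data.Integer as ℤ using (ℤ; +_; 0ℤ; 1ℤ; _-_; _*_; _/ℕ_)
  renaming (_+_ to _⊕_; _≤_ to _≤ᶻ_; _<_ to _<ᶻ_)
open import Data.Product using (Σ; _×_; _,_)
open import Data.Vec using (Vec; []; _∷_)
open import Relation.Nullary using (¬_; yes; no; contradiction)
open import Relation.Binary.PropositionalEquality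
import Data.Nat.Properties as ℕP
import Data.Integer.Properties as ℤP
open import Data.Integer.DivMod using ([n/ℕd]*d≤n; n<s[n/ℕd]*d)
import Data.Nat.Tactic.RingSolver as ℕSolver
import Data.Integer.Tactic.RingSolver as ℤSolver

-- An element of 𝓛ᵢ has lev_i ≤ i (its witness for 𝓝ᵢ can only be i) and
-- lev_{i-1} ≥ i (it is not in 𝓝_{i-1}); as h is monotone and WD ≥ 0,
-- lev_{i-1} ≤ lev_i, so lev_i = i.  For x₁ᵗ∂ₖ we have wt = deg = t, hence
-- WD = n - k and lev_i = hᵢ(n - k) + t - 1 = i determines t and so the monomial.
-- Every other monomial has wt > deg, hence a strictly larger weight-degree.

private
  variable
    i j t t′ : ℕ

wtFrom-suc : ∀ m (xs : Vec ℕ j) → wtFrom (suc m) xs ≡ deg xs ℕ.+ wtFrom m xs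
wtFrom-suc m []       = refl
wtFrom-suc m (x ∷ xs) = begin
  suc m ℕ.* x ℕ.+ wtFrom (suc (suc m)) xs
    ≡⟨ cong (suc m ℕ.* x ℕ.+_) (wtFrom-suc (suc m) xs) ⟩
  suc m ℕ.* x ℕ.+ (deg xs ℕ.+ wtFrom (suc m) xs)
    ≡⟨ shuffle m x (deg xs) (wtFrom (suc m) xs) ⟩
  (x ℕ.+ deg xs) ℕ.+ (m ℕ.* x ℕ.+ wtFrom (suc m) xs) ∎
  where
  open ≡-Reasoning
  shuffle : ∀ m x b c → suc m ℕ.* x ℕ.+ (b ℕ.+ c) ≡ (x ℕ.+ b) ℕ.+ (m ℕ.* x ℕ.+ c)
  shuffle = ℕSolver.solve-∀

deg≤wt : (Λ : Part j) → deg Λ ≤ wt Λ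
deg≤wt Λ rewrite wtFrom-suc 0 Λ = ℕP.m≤m+n (deg Λ) (wtFrom 0 Λ)

deg≡0⇒wtFrom≡0 : ∀ m (xs : Vec ℕ j) → deg xs ≡ 0 → wtFrom m xs ≡ 0
deg≡0⇒wtFrom≡0 m []       _ = refl
deg≡0⇒wtFrom≡0 m (x ∷ xs) p rewrite ℕP.m+n≡0⇒m≡0 x p | ℕP.*-zeroʳ m =
  deg≡0⇒wtFrom≡0 (suc m) xs (ℕP.m+n≡0⇒n≡0 x p)

deg≡0⇒lam≡0 : (xs : Vec ℕ j) → deg xs ≡ 0 → ∀ s → lam xs (suc s) ≡ 0
deg≡0⇒lam≡0 []       _ s       = refl
deg≡0⇒lam≡0 (x ∷ xs) p zero    = ℕP.m+n≡0⇒m≡0 x p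
deg≡0⇒lam≡0 (x ∷ xs) p (suc s) = deg≡0⇒lam≡0 xs (ℕP.m+n≡0⇒n≡0 x p) s

lam≡0⇒deg≡0 : (xs : Vec ℕ j) → (∀ s → lam xs (suc s) ≡ 0) → deg xs ≡ 0
lam≡0⇒deg≡0 []       _ = refl
lam≡0⇒deg≡0 (x ∷ xs) f = cong₂ ℕ._+_ (f zero) (lam≡0⇒deg≡0 xs (λ s → f (suc s)))

lam-injective : (xs ys : Vec ℕ j) → (∀ s → lam xs (suc s) ≡ lam ys (suc s)) → xs ≡ ys
lam-injective []       []       _ = refl
lam-injective (x ∷ xs) (y ∷ ys) f = cong₂ _∷_ (f zero) (lam-injective xs ys (λ s → f (suc s)))

IsX1Pow-injective : (Λ Λ′ : Part j) → IsX1Pow t Λ → IsX1Pow t Λ′ → Λ ≡ Λ′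
IsX1Pow-injective Λ Λ′ p p′ = lam-injective Λ Λ′ (λ s → trans (p (suc s)) (sym (p′ (suc s))))

IsX1Pow⇒deg-tail≡0 : (x : ℕ) (xs : Vec ℕ j) → IsX1Pow t (x ∷ xs) → deg xs ≡ 0
IsX1Pow⇒deg-tail≡0 x xs p = lam≡0⇒deg≡0 xs (λ s → p (suc (suc s)))

IsX1Pow⇒deg≡ : (Λ : Part j) → IsX1Pow t Λ → deg Λ ≡ t
IsX1Pow⇒deg≡ []       p = p 1
IsX1Pow⇒deg≡ (x ∷ xs) p rewrite IsX1Pow⇒deg-tail≡0 x xs p = trans (ℕP.+-identityʳ x) (p 1)

IsX1Pow⇒wt≡deg : (Λ : Part j) → IsX1Pow t Λ → wt Λ ≡ deg Λ
IsX1Pow⇒wt≡deg []       p = refl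
IsX1Pow⇒wt≡deg (x ∷ xs) p
  rewrite IsX1Pow⇒deg-tail≡0 x xs p | deg≡0⇒wtFrom≡0 2 xs (IsX1Pow⇒deg-tail≡0 x xs p)
  = cong (ℕ._+ 0) (ℕP.*-identityˡ x)

-- Since wt = deg + Σₛ (s - 1) λₛ, equality forces λₛ = 0 for s ≥ 2.
wt≡deg⇒IsX1Pow : (Λ : Part j) → wt Λ ≡ deg Λ → IsX1Pow (lam Λ 1) Λ
wt≡deg⇒IsX1Pow []       _ zero          = refl
wt≡deg⇒IsX1Pow []       _ (suc zero)    = refl
wt≡deg⇒IsX1Pow []       _ (suc (suc s)) = refl
wt≡deg⇒IsX1Pow (x ∷ xs) e zero          = refl
wt≡deg⇒IsX1Pow (x ∷ xs) e (suc zero)    = refl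
wt≡deg⇒IsX1Pow (x ∷ xs) e (suc (suc s)) = deg≡0⇒lam≡0 xs tail-deg≡0 s
  where
  excess≡0 : wtFrom 0 (x ∷ xs) ≡ 0
  excess≡0 = ℕP.+-cancelˡ-≡ (deg (x ∷ xs)) _ _
    (trans (sym (wtFrom-suc 0 (x ∷ xs))) (trans e (sym (ℕP.+-identityʳ _))))
  tail-deg≡0 : deg xs ≡ 0
  tail-deg≡0 = ℕP.m+n≡0⇒m≡0 (deg xs) (trans (sym (wtFrom-suc 0 xs)) excess≡0)

/ℕ-monoˡ-≤ : ∀ d .{{_ : ℕ.NonZero d}} {a b : ℤ} → a ≤ᶻ b → (a /ℕ d) ≤ᶻ (b /ℕ d)
/ℕ-monoˡ-≤ d {a} {b} a≤b with (a /ℕ d) ℤP.≤? (b /ℕ d)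
... | yes q = q
... | no q  = contradiction (ℤP.i<j⇒suc[i]≤j (ℤP.≰⇒> q)) (ℤP.<⇒≱ a/d<1+b/d)
  where
  a/d<1+b/d : (a /ℕ d) <ᶻ ℤ.suc (b /ℕ d)
  a/d<1+b/d = ℤP.*-cancelʳ-<-nonNeg (+ d)
    (ℤP.≤-<-trans ([n/ℕd]*d≤n a d) (ℤP.≤-<-trans a≤b (n<s[n/ℕd]*d b d)))

h-mono-≤ : ∀ n {a b} → a ≤ᶻ b → h n a ≤ᶻ h n b
h-mono-≤ n a≤b = ℤP.+-monoˡ-≤ 1ℤ (/ℕ-monoˡ-≤ (suc (n ℕ.∸ 2)) (ℤP.+-monoˡ-≤ ℤ.-1ℤ a≤b))

pred<⇒≤ : ∀ {a b} → ℤ.pred a <ᶻ b → a ≤ᶻ b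
pred<⇒≤ {a} p = subst (_≤ᶻ _) (ℤP.suc-pred a) (ℤP.i<j⇒suc[i]≤j p)

module _ (n k : ℕ) where

  WD-split : (Λ : Part (k ℕ.∸ 1)) → WD n k Λ ≡ (+ wt Λ - + deg Λ) ⊕ (+ n - + k)
  WD-split Λ = ℤP.+-assoc (+ wt Λ - + deg Λ) (+ n) (ℤ.- + k)

  WD-nonneg : k ≤ n → (Λ : Part (k ℕ.∸ 1)) → 0ℤ ≤ᶻ WD n k Λ
  WD-nonneg k≤n Λ = subst (0ℤ ≤ᶻ_) (sym (WD-split Λ)) (
    ℤP.+-mono-≤ (ℤP.i≤j⇒0≤j-i (ℤ.+≤+ (deg≤wt Λ))) (ℤP.i≤j⇒0≤j-i (ℤ.+≤+ k≤n)))

  IsX1Pow⇒WD≡ : (Λ : Part (k ℕ.∸ 1)) → IsX1Pow t Λ → WD n k Λ ≡ + n - + k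
  IsX1Pow⇒WD≡ Λ p = begin
    WD n k Λ                           ≡⟨ WD-split Λ ⟩
    (+ wt Λ - + deg Λ) ⊕ (+ n - + k)
      ≡⟨ cong (λ w → (+ w - + deg Λ) ⊕ (+ n - + k)) (IsX1Pow⇒wt≡deg Λ p) ⟩
    (+ deg Λ - + deg Λ) ⊕ (+ n - + k)  ≡⟨ cong (_⊕ (+ n - + k)) (ℤP.+-inverseʳ (+ deg Λ)) ⟩
    0ℤ ⊕ (+ n - + k)                   ≡⟨ ℤP.+-identityˡ (+ n - + k) ⟩
    + n - + k                          ∎
    where open ≡-Reasoning

  deg<wt⇒WD> : (Λ : Part (k ℕ.∸ 1)) → deg Λ ℕ.< wt Λ → + n - + k <ᶻ WD n k Λ
  deg<wt⇒WD> Λ d<w =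
    subst₂ _<ᶻ_ (ℤP.+-identityˡ (+ n - + k)) (sym (WD-split Λ))
      (ℤP.+-monoˡ-< (+ n - + k) excess>0)
    where
    excess>0 : 0ℤ <ᶻ + wt Λ - + deg Λ
    excess>0 = subst (_<ᶻ + wt Λ - + deg Λ) (ℤP.+-inverseʳ (+ deg Λ))
      (ℤP.+-monoˡ-< (ℤ.- + deg Λ) (ℤ.+<+ d<w))

  lev-mono-≤ : k ≤ n → (Λ : Part (k ℕ.∸ 1)) →
               ∀ {a b} → a ≤ᶻ b → lev n a k Λ ≤ᶻ lev n b k Λ
  lev-mono-≤ k≤n Λ a≤b =
    ℤP.+-monoˡ-≤ ℤ.-1ℤ (ℤP.+-monoˡ-≤ (+ deg Λ)
      (ℤP.*-monoʳ-≤-nonNeg (WD n k Λ) {{ℤ.nonNegative (WD-nonneg k≤n Λ)}} (h-mono-≤ n a≤b)))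

  InL⇒lev≤i : (Λ : Part (k ℕ.∸ 1)) → InL n i k Λ → lev n (+ i) k Λ ≤ᶻ + i
  InL⇒lev≤i {i} Λ ((j , -1≤j , j≤i , lev≤j) , ∉𝓝ᵢ₋₁) with j ℤP.≤? + i - 1ℤ
  ... | yes j≤i-1 = contradiction (j , -1≤j , j≤i-1 , lev≤j) ∉𝓝ᵢ₋₁
  ... | no j≰i-1  = subst (λ j → lev n j k Λ ≤ᶻ j) j≡i lev≤j
    where
    j≡i : j ≡ + i
    j≡i = ℤP.≤-antisym j≤i (pred<⇒≤ (ℤP.≰⇒> j≰i-1))

  InL⇒i≤lev[i-1] : (Λ : Part (k ℕ.∸ 1)) → InL n i k Λ → + i ≤ᶻ lev n (+ i - 1ℤ) k Λ
  InL⇒i≤lev[i-1] {i} Λ (_ , ∉𝓝ᵢ₋₁) with lev n (+ i - 1ℤ) k Λ ℤP.≤? + i - 1ℤ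
  ... | yes lev≤i-1 = contradiction (+ i - 1ℤ , -1≤i-1 , ℤP.≤-refl , lev≤i-1) ∉𝓝ᵢ₋₁
    where
    -1≤i-1 : ℤ.-1ℤ ≤ᶻ + i - 1ℤ
    -1≤i-1 = ℤP.+-monoˡ-≤ ℤ.-1ℤ {0ℤ} {+ i} (ℤ.+≤+ ℕ.z≤n)
  ... | no lev≰i-1  = pred<⇒≤ (ℤP.≰⇒> lev≰i-1)

  InL⇒lev≡i : k ≤ n → (Λ : Part (k ℕ.∸ 1)) → InL n i k Λ → lev n (+ i) k Λ ≡ + i
  InL⇒lev≡i {i} k≤n Λ L = ℤP.≤-antisym (InL⇒lev≤i Λ L)
    (ℤP.≤-trans (InL⇒i≤lev[i-1] Λ L)
                (lev-mono-≤ k≤n Λ (ℤP.i≤j⇒i-k≤j 1ℤ (ℤP.≤-refl {+ i}))))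

  IsX1Pow⇒lev≡ : (Λ : Part (k ℕ.∸ 1)) → IsX1Pow t Λ → ∀ j →
                 lev n j k Λ ≡ (h n j * (+ n - + k) ⊕ + t) - 1ℤ
  IsX1Pow⇒lev≡ Λ p j =
    cong₂ (λ w d → (h n j * w ⊕ + d) - 1ℤ) (IsX1Pow⇒WD≡ Λ p) (IsX1Pow⇒deg≡ Λ p)

  InL-x1-exponent : k ≤ n → (Λ : Part (k ℕ.∸ 1)) → IsX1Pow t Λ → InL n i k Λ →
                    + t ≡ (+ i - h n (+ i) * (+ n - + k)) ⊕ 1ℤ
  InL-x1-exponent {t} {i} k≤n Λ p L = begin
    + t                          ≡⟨ solve-for-t a (+ t) ⟩
    (((a ⊕ + t) - 1ℤ) - a) ⊕ 1ℤ  ≡⟨ cong (λ l → (l - a) ⊕ 1ℤ) lev≡ ⟩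
    (+ i - a) ⊕ 1ℤ               ∎
    where
    open ≡-Reasoning
    a = h n (+ i) * (+ n - + k)
    lev≡ : (a ⊕ + t) - 1ℤ ≡ + i
    lev≡ = trans (sym (IsX1Pow⇒lev≡ Λ p (+ i))) (InL⇒lev≡i k≤n Λ L)
    solve-for-t : ∀ a t → t ≡ (((a ⊕ t) - 1ℤ) - a) ⊕ 1ℤ
    solve-for-t = ℤSolver.solve-∀

  InL-x1-unique : k ≤ n → (Λ Λ′ : Part (k ℕ.∸ 1)) → IsX1Pow t Λ → IsX1Pow t′ Λ′ →
                  InL n i k Λ → InL n i k Λ′ → Λ ≡ Λ′
  InL-x1-unique {t} {t′} k≤n Λ Λ′ p p′ L L′ =
    IsX1Pow-injective Λ Λ′ p (subst (λ u → IsX1Pow u Λ′) (sym t≡t′) p′)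
    where
    t≡t′ : t ≡ t′
    t≡t′ = ℤP.+-injective
      (trans (InL-x1-exponent k≤n Λ p L) (sym (InL-x1-exponent k≤n Λ′ p′ L′)))

  InL-x1-WD-minimal : k ≤ n → (Λ : Part (k ℕ.∸ 1)) → IsX1Pow t Λ → InL n i k Λ →
                      (Λ′ : Part (k ℕ.∸ 1)) → InL n i k Λ′ → ¬ Λ′ ≡ Λ → WD n k Λ <ᶻ WD n k Λ′
  InL-x1-WD-minimal k≤n Λ p L Λ′ L′ Λ′≢Λ =
    subst (_<ᶻ WD n k Λ′) (sym (IsX1Pow⇒WD≡ Λ p))
      (deg<wt⇒WD> Λ′ (ℕP.≤∧≢⇒< (deg≤wt Λ′) deg≢wt))
    where
    deg≢wt : deg Λ′ ≢ wt Λ′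
    deg≢wt d≡w = Λ′≢Λ (InL-x1-unique k≤n Λ′ Λ (wt≡deg⇒IsX1Pow Λ′ (sym d≡w)) p L′ L)

proposition2p14 : (n i k : ℕ) → 2 ≤ n → 1 ≤ k → k ≤ n →
    Σ (Part (k ℕ.∸ 1)) (λ Λ₀ → InL n i k Λ₀) →
    ((t t′ : ℕ) (Λ Λ′ : Part (k ℕ.∸ 1)) → IsX1Pow t Λ → IsX1Pow t′ Λ′ →
       InL n i k Λ → InL n i k Λ′ → Λ ≡ Λ′)
    × ((t : ℕ) (Λ : Part (k ℕ.∸ 1)) → IsX1Pow t Λ → InL n i k Λ →
       ((Λ′ : Part (k ℕ.∸ 1)) → InL n i k Λ′ → ¬ Λ′ ≡ Λ →
          WD n k Λ ℤ.< WD n k Λ′)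
       × (+ t ≡ (+ i ℤ.- h n (+ i) ℤ.* (+ n ℤ.- + k)) ℤ.+ ℤ.1ℤ))
proposition2p14 n i k _ _ k≤n _ =
  (λ t t′ → InL-x1-unique n k k≤n)
  , λ t Λ p L → InL-x1-WD-minimal n k k≤n Λ p L , InL-x1-exponent n k k≤n Λ p L
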